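{- Let $\Gamma\subseteq\mathbb{R}^n$ be a lattice and $E$ a finite list of elements of $\Gamma$. With indeterminates $p_e,v_e$ ($e\in E$), $$\mathbf{Ehr}_E\bigl(\Gamma;(p_ev_e)_{e\in E}\bigr)=\sum_{A\subseteq E}\Bigl(\prod_{e\in A}p_e\Bigr)\mathbf{Ehr}_A\bigl(\Gamma;(v_e)_{e\in A}\bigr)\,\mathbf{Ehr}_{U_{|E\setminus A|}}\bigl(\mathbb{Z}^{E\setminus A};(-p_e)_{e\in E\setminus A}\bigr).$$ In particular, if $p_e=p$ and $v_e=t$ for all $e$, $$\mathrm{Ehr}_{\mathcal{Z}(E)}(\Gamma;pt)=\sum_{A\subseteq E}p^{|A|}\,\mathrm{Ehr}_{\mathcal{Z}(A)}(\Gamma;t)\,\mathrm{Ehr}_{\square_{|E\setminus A|}}\bigl(\mathbb{Z}^{E\setminus A};-p\bigr).$$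
   Context: For a lattice $\Lambda$ and a finite list $A$ in $\Lambda$, $\mathbf{Ehr}_A(\Lambda;\underline v)=\sum_{B\subseteq A\text{ linearly independent}}|(\Lambda/\langle B\rangle)_{\mathrm{tor}}|\prod_{e\in B}v_e$; for positive integers $k_e$ this equals $|\mathcal{Z}(\underline k\cdot A)\cap\Lambda|$ with $\mathcal{Z}(\underline k\cdot A)=\{\sum_{e\in A}\lambda_ek_ee:0\le\lambda_e\le1\}$. $U_d$ is the standard basis of $\mathbb{R}^d$, so $\mathbf{Ehr}_{U_d}(\mathbb{Z}^d;(x_i))=\prod_{i=1}^d(1+x_i)$. $\mathrm{Ehr}_{\mathcal{Z}(A)}(\Lambda;t)$ is the Ehrhart polynomial of the zonotope $\mathcal{Z}(A)=\{\sum_{e\in A}\lambda_ee:0\le\lambda_e\le1\}$ with respect to $\Lambda$, and $\square_d=[0,1]^d$ is the unit cube, so $\mathrm{Ehr}_{\square_d}(\mathbb{Z}^d;x)=(1+x)^d$. -}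

module Defs where

open import Level using (Level)
open import Data.Nat as ℕ using (ℕ; zero; suc)
open import Data.Integer as ℤ using (ℤ; +_)
open import Data.Fin using (Fin; zero; suc)
open import Data.Fin.Subset using (Subset; _∈_; _∉_; inside; outside)
open import Data.Vec using (Vec; []; _∷_)
open import Data.List using (List; []; _∷_; map; _++_; [_])
open import Data.Product using (Σ; _×_; ∃; proj₁)
open import Data.Sum using (_⊎_)
open import Relation.Binary.PropositionalEquality using (_≡_)
open import Relation.Nullary using (¬_)
open import Algebra.Bundles using (CommutativeRing)

-- The lattice Γ is modelled as ℤ^r (Fin r → ℤ).
-- A finite list E of m elements of Γ is  E : Fin m → (Fin r → ℤ).
-- Sublists of E are subsets  Subset m  of the index set Fin m.

ΣFin : ∀ {n} → (Fin n → ℤ) → ℤ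
ΣFin {zero}  f = + 0
ΣFin {suc n} f = f zero ℤ.+ ΣFin (λ i → f (suc i))

module _ {m r : ℕ} (E : Fin m → Fin r → ℤ) where

  lincomb : (Fin m → ℤ) → Fin r → ℤ
  lincomb c i = ΣFin (λ e → c e ℤ.* E e i)

  InSpan : Subset m → (Fin r → ℤ) → Set
  InSpan B x = Σ (Fin m → ℤ) λ c →
                 (∀ e → e ∉ B → c e ≡ + 0) × (∀ i → lincomb c i ≡ x i)

  LinIndep : Subset m → Set
  LinIndep B = ∀ (c : Fin m → ℤ) → (∀ e → e ∉ B → c e ≡ + 0) →
               (∀ i → lincomb c i ≡ + 0) → ∀ e → c e ≡ + 0

  IsTorsion : Subset m → (Fin r → ℤ) → Set
  IsTorsion B x = Σ ℕ λ k → InSpan B (λ i → + suc k ℤ.* x i)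

  SameClass : Subset m → (Fin r → ℤ) → (Fin r → ℤ) → Set
  SameClass B x y = InSpan B (λ i → x i ℤ.- y i)

  TorsionElt : Subset m → Set
  TorsionElt B = Σ (Fin r → ℤ) (IsTorsion B)

  TorsionCard : Subset m → ℕ → Set
  TorsionCard B n = Σ (Fin n → TorsionElt B) λ f →
      (∀ i j → SameClass B (proj₁ (f i)) (proj₁ (f j)) → i ≡ j) ×
      (∀ (y : TorsionElt B) → ∃ λ i → SameClass B (proj₁ (f i)) (proj₁ y))

  -- τ B is the coefficient of Π_{e∈B} v_e in Ehr_E:
  -- |(Γ/⟨B⟩)_tor| if B is linearly independent, and 0 otherwise.
  IsTorsionData : (Subset m → ℕ) → Set
  IsTorsionData τ = ∀ B → (LinIndep B × TorsionCard B (τ B))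
                          ⊎ ((¬ LinIndep B) × τ B ≡ 0)

subsetsOf : ∀ {m} → Subset m → List (Subset m)
subsetsOf []             = [ [] ]
subsetsOf (inside  ∷ A) = map (inside ∷_) (subsetsOf A) ++ map (outside ∷_) (subsetsOf A)
subsetsOf (outside ∷ A) = map (outside ∷_) (subsetsOf A)

module WithRing {c ℓ : Level} (R : CommutativeRing c ℓ) where
  open CommutativeRing R hiding (zero)

  natR : ℕ → Carrier
  natR zero    = 0#
  natR (suc n) = 1# + natR n

  powR : Carrier → ℕ → Carrier
  powR x zero    = 1#
  powR x (suc n) = x * powR x n

  sumL : List Carrier → Carrier
  sumL []       = 0#
  sumL (x ∷ xs) = x + sumL xs

  prodIn : ∀ {m} → Subset m → (Fin m → Carrier) → Carrier
  prodIn []             v = 1#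
  prodIn (inside  ∷ B) v = v zero * prodIn B (λ i → v (suc i))
  prodIn (outside ∷ B) v = prodIn B (λ i → v (suc i))

  prodOut : ∀ {m} → Subset m → (Fin m → Carrier) → Carrier
  prodOut []             w = 1#
  prodOut (inside  ∷ A) w = prodOut A (λ i → w (suc i))
  prodOut (outside ∷ A) w = w zero * prodOut A (λ i → w (suc i))

  -- Ehr_A(Γ; (v_e)_{e∈A}) for the sublist A of E, where τ is the torsion data of E:
  -- Σ_{B ⊆ A} τ(B) Π_{e∈B} v_e  (τ(B) = |(Γ/⟨B⟩)_tor| if B lin. indep., else 0)
  Ehr : ∀ {m} → (Subset m → ℕ) → Subset m → (Fin m → Carrier) → Carrier
  Ehr τ A v = sumL (map (λ B → natR (τ B) * prodIn B v) (subsetsOf A))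

  -- Ehr_{U_{|E∖A|}}(ℤ^{E∖A}; (x_e)_{e∈E∖A}) = Π_{e∈E∖A} (1 + x_e)
  EhrU : ∀ {m} → Subset m → (Fin m → Carrier) → Carrier
  EhrU A x = prodOut A (λ e → 1# + x e)

  -- Ehrhart polynomial of the zonotope Z(A) at t: Ehr_A(Γ; (t)_{e∈A})
  EhrZ : ∀ {m} → (Subset m → ℕ) → Subset m → Carrier → Carrier
  EhrZ τ A t = Ehr τ A (λ _ → t)

  -- Ehr_{□_d}(ℤ^d; x) = (1 + x)^d
  EhrCube : ℕ → Carrier → Carrier
  EhrCube d x = powR (1# + x) d

module Submission where

-- The identity is a statement about generating functions over subsets and
-- holds for ANY coefficient function on subsets, not only for the torsion
-- numbers τ(B): for f : Subset m → R write  Ehrᶠ_A(v) = Σ_{B⊆A} f(B) Π_{e∈B} v_e.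
-- We prove, for every f,
--     Ehrᶠ_E(p·v) = Σ_{A⊆E} (Π_{e∈A} p_e) Ehrᶠ_A(v) Π_{e∉A} (1 - p_e)
-- by induction on the number m of elements of E.  Splitting every sum over
-- subsets according to whether element 0 belongs to the subset shows that
-- both sides satisfy the same recursion  X(f) = p₀v₀·X(f⁺) + X(f⁻),  where f⁺
-- and f⁻ are f restricted to the subsets containing, resp. avoiding, 0 (on
-- the right this uses  p₀y + (1 - p₀)y = y).

open import Defs
open import Level using (Level)
open import Data.Nat using (ℕ; _∸_; zero; suc)
open import Data.Nat.Properties using (+-∸-assoc)
open import Data.Integer using (ℤ)
open import Data.Fin using (Fin; zero; suc)
open import Data.Fin.Subset using (Subset; ⊤; ∣_∣; inside; outside)
open import Data.Fin.Subset.Properties using (∣p∣≤n)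
open import Data.List using (List; []; _∷_; map; _++_)
open import Data.List.Properties using (map-++; map-∘)
open import Data.Product using (_×_; _,_)
open import Data.Vec using (_∷_; [])
open import Algebra.Bundles using (CommutativeRing)
import Relation.Binary.PropositionalEquality as ≡
import Relation.Binary.Reasoning.Setoid as SetoidReasoning
import Algebra.Solver.CommutativeMonoid as CommutativeMonoidSolver
import Algebra.Properties.CommutativeSemigroup as CommutativeSemigroupProperties

module Expansion {c ℓ : Level} (R : CommutativeRing c ℓ) where
  open CommutativeRing R hiding (zero)
  open WithRing R
  open SetoidReasoning setoid
  open CommutativeSemigroupProperties +-commutativeSemigroup
    using () renaming (interchange to +-interchange)
  module Mul = CommutativeMonoidSolver *-commutativeMonoid

  sumL-++ : ∀ (xs ys : List Carrier) → sumL (xs ++ ys) ≈ sumL xs + sumL ys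
  sumL-++ []       ys = sym (+-identityˡ _)
  sumL-++ (x ∷ xs) ys = trans (+-congˡ (sumL-++ xs ys)) (sym (+-assoc _ _ _))

  sumL-cong : ∀ {A : Set} {f g : A → Carrier} (xs : List A) → (∀ x → f x ≈ g x) →
              sumL (map f xs) ≈ sumL (map g xs)
  sumL-cong []       f≈g = refl
  sumL-cong (x ∷ xs) f≈g = +-cong (f≈g x) (sumL-cong xs f≈g)

  sumL-*ˡ : ∀ {A : Set} (k : Carrier) (f : A → Carrier) (xs : List A) →
            sumL (map (λ x → k * f x) xs) ≈ k * sumL (map f xs)
  sumL-*ˡ k f []       = sym (zeroʳ k)
  sumL-*ˡ k f (x ∷ xs) = trans (+-congˡ (sumL-*ˡ k f xs)) (sym (distribˡ k _ _))

  sumL-+ : ∀ {A : Set} (f g : A → Carrier) (xs : List A) →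
           sumL (map (λ x → f x + g x) xs) ≈ sumL (map f xs) + sumL (map g xs)
  sumL-+ f g []       = sym (+-identityˡ 0#)
  sumL-+ f g (x ∷ xs) = trans (+-congˡ (sumL-+ f g xs))
    (+-interchange (f x) (g x) _ _)

  Σ⊆ : ∀ {m} → (Subset m → Carrier) → Subset m → Carrier
  Σ⊆ g A = sumL (map g (subsetsOf A))

  Σ⊆-inside : ∀ {m} (g : Subset (suc m) → Carrier) (A : Subset m) →
              Σ⊆ g (inside ∷ A) ≈ Σ⊆ (λ B → g (inside ∷ B)) A + Σ⊆ (λ B → g (outside ∷ B)) A
  Σ⊆-inside g A = begin
    sumL (map g (map (inside ∷_) L ++ map (outside ∷_) L))
      ≡⟨ ≡.cong sumL (map-++ g (map (inside ∷_) L) _) ⟩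
    sumL (map g (map (inside ∷_) L) ++ map g (map (outside ∷_) L))
      ≈⟨ sumL-++ (map g (map (inside ∷_) L)) (map g (map (outside ∷_) L)) ⟩
    sumL (map g (map (inside ∷_) L)) + sumL (map g (map (outside ∷_) L))
      ≡⟨ ≡.sym (≡.cong₂ _+_ (≡.cong sumL (map-∘ L)) (≡.cong sumL (map-∘ L))) ⟩
    Σ⊆ (λ B → g (inside ∷ B)) A + Σ⊆ (λ B → g (outside ∷ B)) A ∎
    where L = subsetsOf A

  Σ⊆-outside : ∀ {m} (g : Subset (suc m) → Carrier) (A : Subset m) →
               Σ⊆ g (outside ∷ A) ≡.≡ Σ⊆ (λ B → g (outside ∷ B)) A
  Σ⊆-outside g A = ≡.sym (≡.cong sumL (map-∘ (subsetsOf A)))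

  EhrCoeff : ∀ {m} → (Subset m → Carrier) → Subset m → (Fin m → Carrier) → Carrier
  EhrCoeff f A v = Σ⊆ (λ B → f B * prodIn B v) A

  withHead withoutHead : ∀ {m} → (Subset (suc m) → Carrier) → Subset m → Carrier
  withHead    f B = f (inside ∷ B)
  withoutHead f B = f (outside ∷ B)

  tail : ∀ {m} → (Fin (suc m) → Carrier) → Fin m → Carrier
  tail v i = v (suc i)

  EhrCoeff-inside : ∀ {m} (f : Subset (suc m) → Carrier) (A : Subset m) v →
    EhrCoeff f (inside ∷ A) v
      ≈ v zero * EhrCoeff (withHead f) A (tail v) + EhrCoeff (withoutHead f) A (tail v)
  EhrCoeff-inside f A v = begin
    EhrCoeff f (inside ∷ A) v
      ≈⟨ Σ⊆-inside (λ B → f B * prodIn B v) A ⟩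
    Σ⊆ (λ B → f (inside ∷ B) * (v zero * prodIn B (tail v))) A + EhrCoeff (withoutHead f) A (tail v)
      ≈⟨ +-congʳ (sumL-cong (subsetsOf A) λ B →
           Mul.solve 3 (λ a x y → (a Mul.⊕ (x Mul.⊕ y)) Mul.⊜ (x Mul.⊕ (a Mul.⊕ y))) refl
             (f (inside ∷ B)) (v zero) (prodIn B (tail v))) ⟩
    Σ⊆ (λ B → v zero * (f (inside ∷ B) * prodIn B (tail v))) A + EhrCoeff (withoutHead f) A (tail v)
      ≈⟨ +-congʳ (sumL-*ˡ (v zero) _ (subsetsOf A)) ⟩
    v zero * EhrCoeff (withHead f) A (tail v) + EhrCoeff (withoutHead f) A (tail v) ∎

  EhrCoeff-outside : ∀ {m} (f : Subset (suc m) → Carrier) (A : Subset m) v →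
    EhrCoeff f (outside ∷ A) v ≡.≡ EhrCoeff (withoutHead f) A (tail v)
  EhrCoeff-outside f A v = Σ⊆-outside (λ B → f B * prodIn B v) A

  split-weight : ∀ a p y → (a + p * y) + (1# + - p) * y ≈ a + y
  split-weight a p y = begin
    (a + p * y) + (1# + - p) * y
      ≈⟨ +-congˡ (trans (distribʳ y 1# (- p)) (+-congʳ (*-identityˡ y))) ⟩
    (a + p * y) + (y + - p * y)
      ≈⟨ +-interchange a (p * y) y (- p * y) ⟩
    (a + y) + (p * y + - p * y)
      ≈⟨ +-congˡ (trans (sym (distribʳ y p (- p))) (trans (*-congʳ (-‿inverseʳ p)) (zeroˡ y))) ⟩
    (a + y) + 0#
      ≈⟨ +-identityʳ (a + y) ⟩
    a + y ∎

  Expand : ∀ {m} → (Subset m → Carrier) → (p v : Fin m → Carrier) → Carrier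
  Expand f p v = Σ⊆ (λ A → prodIn A p * (EhrCoeff f A v * EhrU A (λ e → - p e))) ⊤

  -- Expand obeys the same recursion as  EhrCoeff f ⊤ (p·v) : the terms with
  -- 0 ∈ A give  p₀v₀ X + p₀ Y,  those with 0 ∉ A give (1 - p₀) Y, and
  -- p₀ Y + (1 - p₀) Y = Y.
  Expand-step : ∀ {m} (f : Subset (suc m) → Carrier) (p v : Fin (suc m) → Carrier) →
    Expand f p v
      ≈ (p zero * v zero) * Expand (withHead f) (tail p) (tail v)
        + Expand (withoutHead f) (tail p) (tail v)
  Expand-step {m} f p v = begin
    Expand f p v
      ≈⟨ Σ⊆-inside term ⊤ ⟩
    Σ⊆ (λ A → term (inside ∷ A)) ⊤ + Σ⊆ (λ A → term (outside ∷ A)) ⊤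
      ≈⟨ +-cong (sumL-cong L termWithHead) (sumL-cong L termWithoutHead) ⟩
    Σ⊆ (λ A → p₀ * v₀ * X A + p₀ * Y A) ⊤ + Σ⊆ (λ A → (1# + - p₀) * Y A) ⊤
      ≈⟨ +-cong (trans (sumL-+ _ _ L) (+-cong (sumL-*ˡ _ X L) (sumL-*ˡ _ Y L)))
                (sumL-*ˡ _ Y L) ⟩
    (p₀ * v₀ * Σ⊆ X ⊤ + p₀ * Σ⊆ Y ⊤) + (1# + - p₀) * Σ⊆ Y ⊤
      ≈⟨ split-weight (p₀ * v₀ * Σ⊆ X ⊤) p₀ (Σ⊆ Y ⊤) ⟩
    p₀ * v₀ * Σ⊆ X ⊤ + Σ⊆ Y ⊤ ∎
    where
      p₀ = p zero
      v₀ = v zero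
      L = subsetsOf (⊤ {m})
      term : Subset (suc m) → Carrier
      term A = prodIn A p * (EhrCoeff f A v * EhrU A (λ e → - p e))
      Q : Subset m → Carrier
      Q A = EhrU A (λ e → - p (suc e))
      X Y : Subset m → Carrier
      X A = prodIn A (tail p) * (EhrCoeff (withHead f) A (tail v) * Q A)
      Y A = prodIn A (tail p) * (EhrCoeff (withoutHead f) A (tail v) * Q A)

      termWithHead : ∀ A → term (inside ∷ A) ≈ p₀ * v₀ * X A + p₀ * Y A
      termWithHead A = begin
        p₀ * P * (EhrCoeff f (inside ∷ A) v * Q A)
          ≈⟨ *-congˡ (*-congʳ (EhrCoeff-inside f A v)) ⟩
        p₀ * P * ((v₀ * Eᵢ + Eₒ) * Q A)
          ≈⟨ *-congˡ (distribʳ (Q A) (v₀ * Eᵢ) Eₒ) ⟩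
        p₀ * P * (v₀ * Eᵢ * Q A + Eₒ * Q A)
          ≈⟨ distribˡ (p₀ * P) _ _ ⟩
        p₀ * P * (v₀ * Eᵢ * Q A) + p₀ * P * (Eₒ * Q A)
          ≈⟨ +-cong (Mul.solve 5 (λ a b P Eᵢ q → ((a Mul.⊕ P) Mul.⊕ ((b Mul.⊕ Eᵢ) Mul.⊕ q))
                                            Mul.⊜ ((a Mul.⊕ b) Mul.⊕ (P Mul.⊕ (Eᵢ Mul.⊕ q))))
                       refl p₀ v₀ P Eᵢ (Q A))
                    (*-assoc p₀ P (Eₒ * Q A)) ⟩
        p₀ * v₀ * X A + p₀ * Y A ∎
        where P = prodIn A (tail p)
              Eᵢ = EhrCoeff (withHead f) A (tail v)
              Eₒ = EhrCoeff (withoutHead f) A (tail v)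

      termWithoutHead : ∀ A → term (outside ∷ A) ≈ (1# + - p₀) * Y A
      termWithoutHead A = begin
        P * (EhrCoeff f (outside ∷ A) v * ((1# + - p₀) * Q A))
          ≡⟨ ≡.cong (λ e → P * (e * ((1# + - p₀) * Q A))) (EhrCoeff-outside f A v) ⟩
        P * (Eₒ * ((1# + - p₀) * Q A))
          ≈⟨ Mul.solve 4 (λ P Eₒ a q → (P Mul.⊕ (Eₒ Mul.⊕ (a Mul.⊕ q))) Mul.⊜ (a Mul.⊕ (P Mul.⊕ (Eₒ Mul.⊕ q))))
               refl P Eₒ (1# + - p₀) (Q A) ⟩
        (1# + - p₀) * Y A ∎
        where P = prodIn A (tail p)
              Eₒ = EhrCoeff (withoutHead f) A (tail v)

  expansion : ∀ m (f : Subset m → Carrier) (p v : Fin m → Carrier) →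
              EhrCoeff f ⊤ (λ e → p e * v e) ≈ Expand f p v
  expansion zero    f p v = sym (trans (+-identityʳ _) (trans (*-identityˡ _) (*-identityʳ _)))
  expansion (suc m) f p v = begin
    EhrCoeff f ⊤ (λ e → p e * v e)
      ≈⟨ EhrCoeff-inside f ⊤ (λ e → p e * v e) ⟩
    (p zero * v zero) * EhrCoeff (withHead f) ⊤ (λ e → tail p e * tail v e)
      + EhrCoeff (withoutHead f) ⊤ (λ e → tail p e * tail v e)
      ≈⟨ +-cong (*-congˡ (expansion m (withHead f) (tail p) (tail v)))
                (expansion m (withoutHead f) (tail p) (tail v)) ⟩
    (p zero * v zero) * Expand (withHead f) (tail p) (tail v)
      + Expand (withoutHead f) (tail p) (tail v)
      ≈⟨ sym (Expand-step f p v) ⟩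
    Expand f p v ∎

  prodIn-const : ∀ {m} (A : Subset m) x → prodIn A (λ _ → x) ≈ powR x ∣ A ∣
  prodIn-const []            x = refl
  prodIn-const (inside ∷ A)  x = *-congˡ (prodIn-const A x)
  prodIn-const (outside ∷ A) x = prodIn-const A x

  prodOut-const : ∀ {m} (A : Subset m) x → prodOut A (λ _ → x) ≈ powR x (m ∸ ∣ A ∣)
  prodOut-const []                  x = refl
  prodOut-const (inside ∷ A)        x = prodOut-const A x
  prodOut-const {suc m} (outside ∷ A) x = begin
    x * prodOut A (λ _ → x)       ≈⟨ *-congˡ (prodOut-const A x) ⟩
    powR x (suc (m ∸ ∣ A ∣))      ≡⟨ ≡.cong (powR x) (≡.sym (+-∸-assoc 1 (∣p∣≤n A))) ⟩
    powR x (suc m ∸ ∣ A ∣)        ∎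

theorem3p19 : ∀ {c ℓ : Level} (R : CommutativeRing c ℓ) {m r : ℕ}
  (E : Fin m → Fin r → ℤ) (τ : Subset m → ℕ) → IsTorsionData E τ →
  let open CommutativeRing R
      open WithRing R
  in (∀ (p v : Fin m → Carrier) →
        Ehr τ ⊤ (λ e → p e * v e)
          ≈ sumL (map (λ A → prodIn A p * (Ehr τ A v * EhrU A (λ e → - p e)))
                      (subsetsOf ⊤)))
     × (∀ (p t : Carrier) →
        EhrZ τ ⊤ (p * t)
          ≈ sumL (map (λ A → powR p ∣ A ∣ * (EhrZ τ A t * EhrCube (m ∸ ∣ A ∣) (- p)))
                      (subsetsOf ⊤)))
theorem3p19 R {m} E τ _ = multivariate , univariate
  where
  open CommutativeRing R
  open WithRing R
  open Expansion R

  multivariate : ∀ (p v : Fin m → Carrier) →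
    Ehr τ ⊤ (λ e → p e * v e)
      ≈ sumL (map (λ A → prodIn A p * (Ehr τ A v * EhrU A (λ e → - p e))) (subsetsOf ⊤))
  multivariate = expansion m (λ B → natR (τ B))

  univariate : ∀ (p t : Carrier) →
    EhrZ τ ⊤ (p * t)
      ≈ sumL (map (λ A → powR p ∣ A ∣ * (EhrZ τ A t * EhrCube (m ∸ ∣ A ∣) (- p))) (subsetsOf ⊤))
  univariate p t = trans (multivariate (λ _ → p) (λ _ → t))
    (sumL-cong (subsetsOf (⊤ {m})) λ A →
      *-cong (prodIn-const A p) (*-congˡ (prodOut-const A (1# + - p))))
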